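{- For all integers $n\ge 1$, $\varphi(1+\varphi(4+\varphi(9+\cdots+\varphi(n^2)\cdots)))\le 57$.
   Context: $\varphi$ denotes Euler's totient function. Precisely, the left-hand side is $x_0$, where $x_n=0$ and $x_{k-1}=\varphi(k^2+x_k)$ for $k=n,n-1,\dots,1$. -}

module Defs where

open import Data.Nat using (ℕ; zero; suc; _+_; _*_)
open import Data.Nat.GCD using (gcd)
open import Data.Nat.Properties using (_≟_)
open import Data.List using (List; length; filter)
open import Data.List.Base using (upTo)
open import Relation.Nullary.Decidable using (Dec)

-- Euler's totient: φ n = #{ k ∈ {1,…,n} : gcd k n ≡ 1 }.
-- (upTo n = [0,…,n-1]; we shift by one to range over 1,…,n.)
φ : ℕ → ℕ
φ n = length (filter (λ k → gcd (suc k) n ≟ 1) (upTo n))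

-- With x_n = 0 and x_{k-1} = φ(k² + x_k): layers (n-k+1) k = x_{k-1}.
layers : ℕ → ℕ → ℕ
layers zero    k = 0
layers (suc m) k = φ (k * k + layers m (suc k))

nestedTotient : ℕ → ℕ
nestedTotient n = layers n 1

module Submission where

-- φ x ≤ x; φ x ≤ x / 2 for even x, since of two consecutive numbers one shares the factor 2
-- with x; and φ x is even for x ≥ 3, since k ↦ x − k pairs off the totatives without fixed
-- point. Hence, for even k ≥ 2, all layers from level k on are even, and two consecutive
-- layers satisfy L(k) ≤ (k² + (k+1)² + L(k+2)) / 2. The quadratic 2k² + 10k + 29 solves this
-- recursion, so L(2) ≤ 57, so L(2) ≤ 56 by parity, and the tower is φ(1 + L(2)) ≤ 57.

open import Defs
open import Data.Nat using (ℕ; zero; suc; _+_; _*_; _≤_; z≤n; s≤s)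
open import Data.Nat.Properties
open import Data.Nat.GCD using (gcd; gcd-greatest; gcd-universality; gcd[m,n]∣m; gcd[m,n]∣n)
open import Data.Nat.Coprimality using (gcd≡1⇒coprime)
open import Data.Nat.Divisibility
open import Data.Nat.ListAction using (sum)
open import Data.Nat.ListAction.Properties using (sum-++)
open import Data.Nat.Tactic.RingSolver using (solve-∀)
open import Data.List using (length; filter; applyUpTo; upTo; [_]; _∷ʳ_)
open import Data.List.Properties using (length-filter; length-upTo; applyUpTo-∷ʳ)
open import Data.Product using (_,_)
open import Data.Sum using (_⊎_; inj₁; inj₂)
open import Function using (_∘_; id)
open import Relation.Nullary using (Dec; yes; no; ¬_; contradiction)
open import Relation.Nullary.Decidable using (toWitnessFalse)
open import Relation.Unary using (Pred; Decidable)
open import Relation.Binary.PropositionalEquality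
  using (_≡_; _≢_; refl; sym; trans; cong; cong₂; subst; module ≡-Reasoning)

𝟙 : ∀ {p} {P : Set p} → Dec P → ℕ
𝟙 (yes _) = 1
𝟙 (no _)  = 0

𝟙≤1 : ∀ {p} {P : Set p} (P? : Dec P) → 𝟙 P? ≤ 1
𝟙≤1 (yes _) = ≤-refl
𝟙≤1 (no _)  = z≤n

𝟙-no : ∀ {p} {P : Set p} (P? : Dec P) → ¬ P → 𝟙 P? ≡ 0
𝟙-no (yes p) ¬p = contradiction p ¬p
𝟙-no (no _)  _  = refl

length-filter-applyUpTo : ∀ {a p} {A : Set a} {P : Pred A p} (P? : Decidable P) (f : ℕ → A) n →
                          length (filter P? (applyUpTo f n)) ≡ sum (applyUpTo (𝟙 ∘ P? ∘ f) n)
length-filter-applyUpTo P? f zero = refl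
length-filter-applyUpTo P? f (suc n) with P? (f 0)
... | yes _ = cong suc (length-filter-applyUpTo P? (f ∘ suc) n)
... | no _  = length-filter-applyUpTo P? (f ∘ suc) n

sum-applyUpTo-suc : ∀ (g : ℕ → ℕ) n → sum (applyUpTo g (suc n)) ≡ sum (applyUpTo g n) + g n
sum-applyUpTo-suc g n = begin
  sum (applyUpTo g (suc n))        ≡⟨ cong sum (applyUpTo-∷ʳ g n) ⟨
  sum (applyUpTo g n ∷ʳ g n)       ≡⟨ sum-++ (applyUpTo g n) [ g n ] ⟩
  sum (applyUpTo g n) + (g n + 0)  ≡⟨ cong (sum (applyUpTo g n) +_) (+-identityʳ (g n)) ⟩
  sum (applyUpTo g n) + g n        ∎
  where open ≡-Reasoning

sum-applyUpTo[e*2]≤e : ∀ {g : ℕ → ℕ} → (∀ i → g i + g (suc i) ≤ 1) → ∀ e → sum (applyUpTo g (e * 2)) ≤ e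
sum-applyUpTo[e*2]≤e g≤1 zero = z≤n
sum-applyUpTo[e*2]≤e {g} g≤1 (suc e) = begin
  g 0 + (g 1 + sum (applyUpTo (g ∘ suc ∘ suc) (e * 2)))  ≡⟨ +-assoc (g 0) (g 1) _ ⟨
  g 0 + g 1 + sum (applyUpTo (g ∘ suc ∘ suc) (e * 2))    ≤⟨ +-mono-≤ (g≤1 0) (sum-applyUpTo[e*2]≤e (g≤1 ∘ suc ∘ suc) e) ⟩
  suc e                                                   ∎
  where open ≤-Reasoning

Palindromic : ℕ → (ℕ → ℕ) → Set
Palindromic n g = ∀ i j → suc (i + j) ≡ n → g i ≡ g j

2∣sum-applyUpTo-palindromic : ∀ n {g : ℕ → ℕ} → Palindromic n g → (∀ i → suc (i + i) ≡ n → 2 ∣ g i) →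
                              2 ∣ sum (applyUpTo g n)
2∣sum-applyUpTo-palindromic zero          _   _      = 2 ∣0
2∣sum-applyUpTo-palindromic (suc zero)    _   middle = ∣m∣n⇒∣m+n (middle 0 refl) (2 ∣0)
2∣sum-applyUpTo-palindromic (suc (suc n)) {g} palindromic middle =
  subst (2 ∣_) (sym sum≡inner+2*outer) (∣m∣n⇒∣m+n 2∣inner (n∣m*n (g 0)))
  where
    inward : ∀ {i j} → suc (i + j) ≡ n → suc (suc i + suc j) ≡ suc (suc n)
    inward {i} {j} eq = cong (suc ∘ suc) (trans (+-suc i j) eq)

    inner : ℕ
    inner = sum (applyUpTo (g ∘ suc) n)

    2∣inner : 2 ∣ inner
    2∣inner = 2∣sum-applyUpTo-palindromic n
      (λ i j → palindromic (suc i) (suc j) ∘ inward) (λ i → middle (suc i) ∘ inward)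

    regroup : ∀ a s → a + (s + a) ≡ s + a * 2
    regroup = solve-∀

    sum≡inner+2*outer : sum (applyUpTo g (suc (suc n))) ≡ inner + g 0 * 2
    sum≡inner+2*outer = begin
      g 0 + sum (applyUpTo (g ∘ suc) (suc n))  ≡⟨ cong (g 0 +_) (sum-applyUpTo-suc (g ∘ suc) n) ⟩
      g 0 + (inner + g (suc n))                ≡⟨ cong (λ x → g 0 + (inner + x)) (palindromic 0 (suc n) refl) ⟨
      g 0 + (inner + g 0)                      ≡⟨ regroup (g 0) inner ⟩
      inner + g 0 * 2                          ∎
      where open ≡-Reasoning

∣-complement : ∀ {d i j m} → i + j ≡ m → d ∣ m → d ∣ i → d ∣ j
∣-complement {d} eq d∣m d∣i = ∣m+n∣m⇒∣n (subst (d ∣_) (sym eq) d∣m) d∣i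

gcd-complement : ∀ {i j m} → i + j ≡ m → gcd i m ≡ gcd j m
gcd-complement {i} {j} {m} eq = gcd-universality
  (λ (d∣j , d∣m) → gcd-greatest (∣-complement (trans (+-comm j i) eq) d∣m d∣j) d∣m)
  (λ d∣gcd → let d∣i = ∣-trans d∣gcd (gcd[m,n]∣m i m)
                 d∣m = ∣-trans d∣gcd (gcd[m,n]∣n i m)
             in ∣-complement eq d∣m d∣i , d∣m)

2∣n⊎2∣1+n : ∀ n → 2 ∣ n ⊎ 2 ∣ suc n
2∣n⊎2∣1+n zero    = inj₁ (2 ∣0)
2∣n⊎2∣1+n (suc n) with 2∣n⊎2∣1+n n
... | inj₁ 2∣n   = inj₂ (∣m∣n⇒∣m+n ∣-refl 2∣n)
... | inj₂ 2∣1+n = inj₁ 2∣1+n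

-- upTo m lists 0, …, m − 1, so index i stands for the candidate totative i + 1.
χ : ℕ → ℕ → ℕ
χ m i = 𝟙 (gcd (suc i) m ≟ 1)

φ≡sum-χ : ∀ m → φ m ≡ sum (applyUpTo (χ m) m)
φ≡sum-χ m = length-filter-applyUpTo (λ k → gcd (suc k) m ≟ 1) id m

χ≡0 : ∀ {d m i} → d ∣ suc i → d ∣ m → d ≢ 1 → χ m i ≡ 0
χ≡0 {d} {m} {i} d∣1+i d∣m d≢1 =
  𝟙-no (gcd (suc i) m ≟ 1) (λ gcd≡1 → d≢1 (gcd≡1⇒coprime gcd≡1 (d∣1+i , d∣m)))

φ[n]≤n : ∀ n → φ n ≤ n
φ[n]≤n n = ≤-trans (length-filter _ (upTo n)) (≤-reflexive (length-upTo n))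

2∣n⇒2*φ[n]≤n : ∀ {n} → 2 ∣ n → 2 * φ n ≤ n
2∣n⇒2*φ[n]≤n {n} (divides e refl) = begin
  2 * φ n                      ≡⟨ cong (2 *_) (φ≡sum-χ n) ⟩
  2 * sum (applyUpTo (χ n) n)  ≤⟨ *-monoʳ-≤ 2 (sum-applyUpTo[e*2]≤e adjacent e) ⟩
  2 * e                        ≡⟨ *-comm 2 e ⟩
  n                            ∎
  where
    open ≤-Reasoning
    adjacent : ∀ i → χ n i + χ n (suc i) ≤ 1
    adjacent i with 2∣n⊎2∣1+n (suc i)
    ... | inj₁ 2∣1+i rewrite χ≡0 2∣1+i (n∣m*n e) (λ ()) = 𝟙≤1 _
    ... | inj₂ 2∣2+i rewrite χ≡0 2∣2+i (n∣m*n e) (λ ()) | +-identityʳ (χ n i) = 𝟙≤1 _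

3≤n⇒2∣φ[n] : ∀ {n} → 3 ≤ n → 2 ∣ φ n
3≤n⇒2∣φ[n] {suc n} 3≤1+n = subst (2 ∣_) (sym φ≡S) (2∣sum-applyUpTo-palindromic n palindromic middle)
  where
    S : ℕ
    S = sum (applyUpTo (χ (suc n)) n)

    φ≡S : φ (suc n) ≡ S
    φ≡S = begin
      φ (suc n)                            ≡⟨ φ≡sum-χ (suc n) ⟩
      sum (applyUpTo (χ (suc n)) (suc n))  ≡⟨ sum-applyUpTo-suc (χ (suc n)) n ⟩
      S + χ (suc n) n                      ≡⟨ cong (S +_) (χ≡0 {i = n} ∣-refl ∣-refl 1+n≢1) ⟩
      S + 0                                ≡⟨ +-identityʳ S ⟩
      S                                    ∎
      where
        open ≡-Reasoning
        1+n≢1 : suc n ≢ 1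
        1+n≢1 = >⇒≢ (≤-trans (n≤1+n 2) 3≤1+n)

    palindromic : Palindromic n (χ (suc n))
    palindromic i j eq =
      cong (λ g → 𝟙 (g ≟ 1)) (gcd-complement {suc i} {suc j} (cong suc (trans (+-suc i j) eq)))

    middle : ∀ i → suc (i + i) ≡ n → 2 ∣ χ (suc n) i
    middle i eq = subst (2 ∣_) (sym (χ≡0 {i = i} ∣-refl 1+i∣1+n 1+i≢1)) (2 ∣0)
      where
        1+i+1+i≡1+n : suc i + suc i ≡ suc n
        1+i+1+i≡1+n = cong suc (trans (+-suc i i) eq)
        1+i∣1+n : suc i ∣ suc n
        1+i∣1+n = subst (suc i ∣_) 1+i+1+i≡1+n (∣m∣n⇒∣m+n ∣-refl ∣-refl)
        1+i≢1 : suc i ≢ 1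
        1+i≢1 1+i≡1 = >⇒≢ 3≤1+n (trans (sym 1+i+1+i≡1+n) (cong₂ _+_ 1+i≡1 1+i≡1))

layers-even : ∀ m {k} → 2 ≤ k → 2 ∣ layers m k
layers-even zero        _   = 2 ∣0
layers-even (suc m) {k} 2≤k =
  3≤n⇒2∣φ[n] (≤-trans (n≤1+n 3) (≤-trans (*-mono-≤ 2≤k 2≤k) (m≤m+n (k * k) _)))

evenLayerBound : ℕ → ℕ
evenLayerBound k = 2 * (k * k) + 10 * k + 29

layers≤evenLayerBound : ∀ m {k} → 2 ∣ k → 2 ≤ k → layers m k ≤ evenLayerBound k
layers≤evenLayerBound zero          _   _   = z≤n
layers≤evenLayerBound (suc zero)    {k} _ _ = begin
  φ (k * k + 0)         ≤⟨ φ[n]≤n (k * k + 0) ⟩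
  k * k + 0             ≤⟨ +-monoʳ-≤ (k * k) z≤n ⟩
  2 * (k * k)           ≤⟨ m≤m+n _ (10 * k) ⟩
  2 * (k * k) + 10 * k  ≤⟨ m≤m+n _ 29 ⟩
  evenLayerBound k      ∎
  where open ≤-Reasoning
layers≤evenLayerBound (suc (suc m)) {k} 2∣k 2≤k = *-cancelˡ-≤ 2 (begin
  2 * φ (k * k + layers (suc m) (suc k))            ≤⟨ 2∣n⇒2*φ[n]≤n argument-even ⟩
  k * k + φ (suc k * suc k + layers m (2 + k))      ≤⟨ +-monoʳ-≤ (k * k) (φ[n]≤n _) ⟩
  k * k + (suc k * suc k + layers m (2 + k))        ≤⟨ +-monoʳ-≤ (k * k) (+-monoʳ-≤ (suc k * suc k) ih) ⟩
  k * k + (suc k * suc k + evenLayerBound (2 + k))  ≡⟨ two-layers k ⟩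
  2 * evenLayerBound k                              ∎)
  where
    open ≤-Reasoning
    argument-even : 2 ∣ k * k + layers (suc m) (suc k)
    argument-even = ∣m∣n⇒∣m+n (∣m⇒∣m*n k 2∣k) (layers-even (suc m) (m≤n⇒m≤1+n 2≤k))

    ih : layers m (2 + k) ≤ evenLayerBound (2 + k)
    ih = layers≤evenLayerBound m (∣m∣n⇒∣m+n ∣-refl 2∣k) (s≤s (s≤s z≤n))

    two-layers : ∀ k → k * k + (suc k * suc k + (2 * ((2 + k) * (2 + k)) + 10 * (2 + k) + 29))
                     ≡ 2 * (2 * (k * k) + 10 * k + 29)
    two-layers = solve-∀

corollary4p1p2 : (n : ℕ) → 1 ≤ n → nestedTotient n ≤ 57
corollary4p1p2 (suc m) _ = begin
  φ (1 + layers m 2)  ≤⟨ φ[n]≤n (1 + layers m 2) ⟩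
  1 + layers m 2      ≤⟨ ≤∧≢⇒< (layers≤evenLayerBound m ∣-refl ≤-refl) layers≢57 ⟩
  57                  ∎
  where
    open ≤-Reasoning
    layers≢57 : layers m 2 ≢ 57
    layers≢57 eq = toWitnessFalse {a? = 2 ∣? 57} _ (subst (2 ∣_) eq (layers-even m ≤-refl))
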